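{- Let $p\ge 11$ be a prime with $p\equiv 2\pmod 3$, $m=(p+1)/3$ and $I=\{m,\ldots,2m-1\}\subset\mathbb{F}_p$. Let $d\in\{0,\ldots,m-1\}$ and let $J\subset\{m-d,m-d+1,\ldots,2m-1+d\}\subset\mathbb{F}_p$ have size at least $d+1$ and be contained in a translate $t+I$ of $I$. Then $\mathbb{F}_p\setminus(I+J)\subset\{|J|-d,\,|J|-d+1,\ldots,d-|J|\}$, where the latter denotes the set of residues $|J|-d+k \bmod p$ for $k=0,1,\ldots,p-2(|J|-d)$ (i.e. the complement of $\{ -(|J|-d-1),\ldots,|J|-d-1\}$).
   Context: Integer intervals $\{a,\ldots,b\}$ are read as subsets of $\mathbb{F}_p=\mathbb{Z}/p\mathbb{Z}$ via reduction mod $p$. -}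

module Defs where

open import Data.Nat using (ℕ; _+_; _*_; _∸_; _≤_)
open import Data.Fin using (Fin; toℕ)
open import Data.Fin.Subset using (Subset; _∈_; _∉_)
open import Data.Product using (Σ; ∃; _×_)
open import Relation.Binary.PropositionalEquality using (_≡_)

ResidueOf : (p : ℕ) → ℕ → Fin p → Set
ResidueOf p a x = ∃ λ q → a ≡ toℕ x + q * p

InInterval : (p : ℕ) → ℕ → ℕ → Fin p → Set
InInterval p a b x = ∃ λ i → (a ≤ i) × (i ≤ b) × ResidueOf p i x

SubsetOfTranslate : (p : ℕ) → Subset p → Fin p → ℕ → ℕ → Set
SubsetOfTranslate p J t a b =
  ∀ j → j ∈ J → ∃ λ i → (a ≤ i) × (i ≤ b) × ResidueOf p (toℕ t + i) j

InSumset : (p : ℕ) → ℕ → ℕ → Subset p → Fin p → Set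
InSumset p a b J x =
  ∃ λ i → ∃ λ j → (a ≤ i) × (i ≤ b) × (j ∈ J) × ResidueOf p (i + toℕ j) x

-- Since 2m + d ≤ p, every j ∈ J is its own representative
-- in [m − d, 2m + d), and a residue x outside {k, …, p − k} (k = |J| − d) lifts to some
-- y ≡ x with p − k < y < p + k. If y ∉ I + J, each j ∈ J is either near (y < j + m) or
-- far (j + 2m ≤ y). If all are near, J ⊆ [y + 1 − m, 2m + d); if all are far,
-- J ⊆ [m − d, y + 1 − 2m); both intervals have fewer than |J| = d + k points. A near and a
-- far element differ by more than m, which is impossible because J fits in a window
-- [s, s + m) of integers: lifting J ⊆ t + I either never or always wraps around p, since
-- otherwise J would lie in two intervals of total length 2d + 1 − m ≤ d.
module Submission where

open import Defs
open import Data.Nat using (ℕ; suc; _+_; _*_; _∸_; _≤_; _<_; _%_)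
open import Data.Nat.Primality using (Prime)
open import Data.Fin using (Fin; toℕ)
open import Data.Fin.Subset using (Subset; _∈_; ∣_∣)
open import Relation.Binary.PropositionalEquality using (_≡_)
open import Relation.Nullary using (¬_)

open import Data.Empty using (⊥; ⊥-elim)
open import Data.Fin using (zero; suc)
open import Data.Fin.Properties using (any?; toℕ<n)
open import Data.Fin.Subset using (inside; outside)
open import Data.Fin.Subset.Properties using (_∈?_)
open import Data.List using ([]; _∷_)
open import Data.Nat using (zero; z≤n; s≤s; pred; _≤?_; _<?_)
open import Data.Nat.Properties
open import Algebra.Properties.CommutativeSemigroup +-commutativeSemigroup using (interchange)
open import Data.Nat.Tactic.RingSolver using (solve)
open import Data.Product using (∃; ∃-syntax; _×_; _,_; proj₁; proj₂)
import Data.Product as Product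
open import Data.Sum using (_⊎_; inj₁; inj₂; [_,_]′)
import Data.Sum as Sum
open import Data.Vec using (here; there)
import Data.Vec as Vec
open import Function using (id)
open import Relation.Binary.PropositionalEquality using (refl; sym; cong; cong₂; subst; _≢_)
open import Relation.Nullary using (Dec; yes; no; contradiction)
open import Relation.Nullary.Decidable using (_×-dec_)

infix 4 _≤_<_
_≤_<_ : ℕ → ℕ → ℕ → Set
a ≤ v < b = (a ≤ v) × (v < b)

infixl 6 _⊕_
_⊕_ : ∀ {a b c d} → a ≤ b → c ≤ d → a + c ≤ b + d
_⊕_ = +-mono-≤

-- Linear arithmetic by certificate: add up the hypotheses to L ≤ R and let the ring solver
-- check that L exceeds R by a positive constant. Opaque, so that the type checker never
-- normalises the solver's certificates.
opaque
  sum-contradiction : ∀ {L R} → L ≤ R → ∀ r → L ≡ R + suc r → ⊥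
  sum-contradiction {R = R} L≤R r refl = m+1+n≰m R L≤R

0<m≤o∸n⇒m+n≤o : ∀ {m n o} → 0 < m → m ≤ o ∸ n → m + n ≤ o
0<m≤o∸n⇒m+n≤o {m} {n} {o} 0<m m≤o∸n = m≤o∸n⇒m+n≤o m n≤o m≤o∸n
  where
  n≤o : n ≤ o
  n≤o = ≮⇒≥ λ o<n → <⇒≱ 0<m (subst (m ≤_) (m≤n⇒m∸n≡0 (<⇒≤ o<n)) m≤o∸n)

≤∸1+⇒<+ : ∀ {n i d} → 0 < n → i ≤ n ∸ 1 + d → i < n + d
≤∸1+⇒<+ {suc n} _ i≤n+d = s≤s i≤n+d

≤∸1⇒< : ∀ {n i} → 0 < n → i ≤ n ∸ 1 → i < n
≤∸1⇒< {suc n} _ i≤n = s≤s i≤n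

<⇒≤∸1 : ∀ {n i} → i < n → i ≤ n ∸ 1
<⇒≤∸1 {suc n} (s≤s i≤n) = i≤n

offset-trichotomy : ∀ {a b} v y →
                    y < v + a ⊎ (∃[ i ] (a ≤ i < b × i + v ≡ y)) ⊎ v + b ≤ y
offset-trichotomy {a} {b} v y with y <? v + a | y <? v + b
... | yes y<v+a | _         = inj₁ y<v+a
... | no  _     | no y≮v+b  = inj₂ (inj₂ (≮⇒≥ y≮v+b))
... | no  y≮v+a | yes y<v+b = inj₂ (inj₁ (y ∸ v , (a≤y∸v , y∸v<b) , m∸n+n≡m v≤y))
  where
  v+a≤y : v + a ≤ y
  v+a≤y = ≮⇒≥ y≮v+a
  v≤y : v ≤ y
  v≤y = ≤-trans (m≤m+n v a) v+a≤y
  a≤y∸v : a ≤ y ∸ v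
  a≤y∸v = m+n≤o⇒m≤o∸n a (subst (_≤ y) (+-comm v a) v+a≤y)
  y∸v<b : y ∸ v < b
  y∸v<b = subst (y ∸ v <_) (m+n∸m≡n v b) (∸-monoˡ-< y<v+b v≤y)

pred∸pred≤∸ : ∀ a b → pred b ∸ pred a ≤ b ∸ a
pred∸pred≤∸ zero    b       = pred[n]≤n
pred∸pred≤∸ (suc a) zero    = ≤-reflexive (0∸n≡0 a)
pred∸pred≤∸ (suc a) (suc b) = ≤-refl

pred-≤< : ∀ {a v b} → a ≤ suc v < b → pred a ≤ v < pred b
pred-≤< (a≤1+v , 1+v<b) = pred-mono-≤ a≤1+v , suc[m]≤n⇒m≤pred[n] 1+v<b

drop-∷-⊆-intervals : ∀ {n x a b c e} {J : Subset n} →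
                     (∀ j → j ∈ x Vec.∷ J → (a ≤ toℕ j < b) ⊎ (c ≤ toℕ j < e)) →
                     ∀ j → j ∈ J → (pred a ≤ toℕ j < pred b) ⊎ (pred c ≤ toℕ j < pred e)
drop-∷-⊆-intervals J⊆ j j∈J = Sum.map pred-≤< pred-≤< (J⊆ (suc j) (there j∈J))

∣p∣≤∸+∸ : ∀ {n a b c e} (J : Subset n) →
          (∀ j → j ∈ J → (a ≤ toℕ j < b) ⊎ (c ≤ toℕ j < e)) → ∣ J ∣ ≤ (b ∸ a) + (e ∸ c)
∣p∣≤∸+∸ Vec.[] _ = z≤n
∣p∣≤∸+∸ {a = a} {b} {c} {e} (outside Vec.∷ J) J⊆ =
  ≤-trans (∣p∣≤∸+∸ J (drop-∷-⊆-intervals J⊆)) (pred∸pred≤∸ a b ⊕ pred∸pred≤∸ c e)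
∣p∣≤∸+∸ {a = a} {b} {c} {e} (inside Vec.∷ J) J⊆ with J⊆ zero here
... | inj₁ (z≤n , s≤s _) =
  s≤s (≤-trans (∣p∣≤∸+∸ J (drop-∷-⊆-intervals J⊆)) (+-monoʳ-≤ _ (pred∸pred≤∸ c e)))
... | inj₂ (z≤n , s≤s _) = ≤-trans
  (s≤s (≤-trans (∣p∣≤∸+∸ J (drop-∷-⊆-intervals J⊆)) (+-monoˡ-≤ _ (pred∸pred≤∸ a b))))
  (≤-reflexive (sym (+-suc _ _)))

∣p∣≤∸ : ∀ {n a b} (J : Subset n) → (∀ j → j ∈ J → a ≤ toℕ j < b) → ∣ J ∣ ≤ b ∸ a
∣p∣≤∸ J J⊆ = ≤-trans (∣p∣≤∸+∸ {c = 0} {e = 0} J (λ j j∈J → inj₁ (J⊆ j j∈J)))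
                     (≤-reflexive (+-identityʳ _))

∣p∣+[a+c]≤b+e : ∀ {n a b c e} (J : Subset n) → a ≤ b → c ≤ e →
                (∀ j → j ∈ J → (a ≤ toℕ j < b) ⊎ (c ≤ toℕ j < e)) → ∣ J ∣ + (a + c) ≤ b + e
∣p∣+[a+c]≤b+e {a = a} {b} {c} {e} J a≤b c≤e J⊆ = begin
  ∣ J ∣ + (a + c)             ≤⟨ +-monoˡ-≤ (a + c) (∣p∣≤∸+∸ J J⊆) ⟩
  (b ∸ a) + (e ∸ c) + (a + c) ≡⟨ interchange (b ∸ a) (e ∸ c) a c ⟩
  (b ∸ a + a) + (e ∸ c + c)   ≡⟨ cong₂ _+_ (m∸n+n≡m a≤b) (m∸n+n≡m c≤e) ⟩
  b + e                       ∎
  where open ≤-Reasoning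

residue-toℕ : ∀ {p} (x : Fin p) → ResidueOf p (toℕ x) x
residue-toℕ x = 0 , sym (+-identityʳ (toℕ x))

residue<p⇒toℕ≡ : ∀ {p a} {x : Fin p} → ResidueOf p a x → a < p → toℕ x ≡ a
residue<p⇒toℕ≡ (zero , refl) _ = sym (+-identityʳ _)
residue<p⇒toℕ≡ {p} {x = x} (suc q , refl) a<p =
  contradiction a<p (≤⇒≯ (≤-trans (m≤m+n p (q * p)) (m≤n+m _ (toℕ x))))

residue<2p⇒toℕ≡⊎toℕ+p≡ : ∀ {p a} {x : Fin p} → ResidueOf p a x → a < 2 * p →
                          toℕ x ≡ a ⊎ toℕ x + p ≡ a
residue<2p⇒toℕ≡⊎toℕ+p≡ (zero , refl) _ = inj₁ (sym (+-identityʳ _))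
residue<2p⇒toℕ≡⊎toℕ+p≡ {p} {x = x} (suc zero , refl) _ =
  inj₂ (cong (toℕ x +_) (sym (+-identityʳ p)))
residue<2p⇒toℕ≡⊎toℕ+p≡ {p} {x = x} (suc (suc q) , refl) a<2p =
  contradiction a<2p (≤⇒≯ (≤-trans (+-monoʳ-≤ p (+-monoʳ-≤ p z≤n)) (m≤n+m _ (toℕ x))))

InInterval⇒≤toℕ≤ : ∀ {p a b} {x : Fin p} → InInterval p a b x → b < p →
                   a ≤ toℕ x × toℕ x ≤ b
InInterval⇒≤toℕ≤ (i , a≤i , i≤b , res) b<p =
  subst (λ v → _ ≤ v × v ≤ _) (sym (residue<p⇒toℕ≡ res (≤-<-trans i≤b b<p))) (a≤i , i≤b)

SubsetOfTranslate⇒lift : ∀ {p a b} {J : Subset p} {t : Fin p} →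
                         SubsetOfTranslate p J t a b → b < p → ∀ j → j ∈ J →
                         ∃[ i ] (a ≤ i × i ≤ b × (toℕ j ≡ toℕ t + i ⊎ toℕ j + p ≡ toℕ t + i))
SubsetOfTranslate⇒lift {p} {t = t} J⊆t+I b<p j j∈J with J⊆t+I j j∈J
... | i , a≤i , i≤b , res = i , a≤i , i≤b , residue<2p⇒toℕ≡⊎toℕ+p≡ res t+i<2p
  where
  t+i<2p : toℕ t + i < 2 * p
  t+i<2p = <-≤-trans (+-mono-< (toℕ<n t) (≤-<-trans i≤b b<p)) (+-monoʳ-≤ p (m≤m+n p 0))

2m+e≤p : ∀ {p m e} → 3 * m ≡ p + 1 → e < m → 2 * m + e ≤ p
2m+e≤p {p} {m} {e} 3m≡p+1 e<m = ≮⇒≥ λ (p<2m+e : p < 2 * m + e) →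
  sum-contradiction (p<2m+e ⊕ e<m ⊕ ≤-reflexive 3m≡p+1) 0 (solve (p ∷ m ∷ e ∷ []))

module Lifted {p m d k : ℕ} (3m≡p+1 : 3 * m ≡ p + 1) (d<m : d < m)
  (J : Subset p) (∣J∣≡d+k : ∣ J ∣ ≡ d + k) (0<k : 0 < k)
  (J⊆range : ∀ j → j ∈ J → m ∸ d ≤ toℕ j < 2 * m + d) where

  Window : ℕ → Set
  Window s = ∀ j → j ∈ J → s ≤ toℕ j < s + m

  Misses : ℕ → Set
  Misses y = ∀ j → j ∈ J → ∀ i → m ≤ i < 2 * m → i + toℕ j ≢ y

  private
    m≤p : m ≤ p
    m≤p = ≤-trans (m≤m+n m (m + 0))
                  (≤-trans (m≤m+n (2 * m) 0) (2m+e≤p 3m≡p+1 (≤-trans (s≤s z≤n) d<m)))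

    0<d+k : 0 < d + k
    0<d+k = ≤-trans 0<k (m≤n+m k d)

    ∣J∣+X≤Y⇒d+k+X≤Y : ∀ {X Y} → ∣ J ∣ + X ≤ Y → d + k + X ≤ Y
    ∣J∣+X≤Y⇒d+k+X≤Y {X} = subst (λ N → N + X ≤ _) ∣J∣≡d+k

    ⊆interval⇒d+k+a≤b : ∀ {a b} → (∀ j → j ∈ J → a ≤ toℕ j < b) → d + k + a ≤ b
    ⊆interval⇒d+k+a≤b J⊆ = 0<m≤o∸n⇒m+n≤o 0<d+k (subst (_≤ _) ∣J∣≡d+k (∣p∣≤∸ J J⊆))

  module _ (T : ℕ)
    (J⊆T+I : ∀ j → j ∈ J → ∃[ i ] (m ≤ i < 2 * m × (toℕ j ≡ T + i ⊎ toℕ j + p ≡ T + i)))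
    where

    private
      unwrapped-or-wrapped : ∀ j → j ∈ J →
                             (T + m ≤ toℕ j < T + 2 * m) ⊎ (T + m ≤ toℕ j + p < T + 2 * m)
      unwrapped-or-wrapped j j∈J with J⊆T+I j j∈J
      ... | i , (m≤i , i<2m) , lift = Sum.map in-T+I in-T+I lift
        where
        in-T+I : ∀ {v} → v ≡ T + i → T + m ≤ v < T + 2 * m
        in-T+I refl = +-monoʳ-≤ T m≤i , +-monoʳ-< T i<2m

      wrapped⇒<T+m : ∀ v → v + p < T + 2 * m → v < T + m
      wrapped⇒<T+m v v+p<T+2m = ≰⇒> λ (T+m≤v : T + m ≤ v) →
        sum-contradiction (T+m≤v ⊕ v+p<T+2m ⊕ m≤p) 0 (solve (v ∷ T ∷ m ∷ p ∷ []))

      unwrapped : ∀ {j} → j ∈ J → T + m ≤ toℕ j → T + m ≤ toℕ j < T + 2 * m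
      unwrapped {j} j∈J T+m≤j =
        [ id , (λ (_ , j+p<T+2m) → contradiction T+m≤j (<⇒≱ (wrapped⇒<T+m _ j+p<T+2m))) ]′
        (unwrapped-or-wrapped j j∈J)

      wrapped : ∀ {j} → j ∈ J → toℕ j < T + m → T + m ≤ toℕ j + p < T + 2 * m
      wrapped {j} j∈J j<T+m =
        [ (λ (T+m≤j , _) → contradiction T+m≤j (<⇒≱ j<T+m)) , id ]′ (unwrapped-or-wrapped j j∈J)

      unwrapped-window : ∀ {v} → T + m ≤ v < T + 2 * m → T + m ≤ v < T + m + m
      unwrapped-window (T+m≤v , v<T+2m) =
        T+m≤v , ≤-trans v<T+2m (≤-reflexive (solve (T ∷ m ∷ [])))

      wrapped-window : ∀ {v} → T + m ≤ v + p < T + 2 * m → T + m ∸ p ≤ v < T + m ∸ p + m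
      wrapped-window {v} (T+m≤v+p , v+p<T+2m) =
        m≤n+o⇒m∸n≤o (T + m) p (subst (T + m ≤_) (+-comm v p) T+m≤v+p) ,
        below (m≤n+m∸n (T + m) p)
        where
        below : ∀ {s} → T + m ≤ p + s → v < s + m
        below {s} T+m≤p+s = ≰⇒> λ (s+m≤v : s + m ≤ v) →
          sum-contradiction (s+m≤v ⊕ v+p<T+2m ⊕ T+m≤p+s) 0 (solve (v ∷ s ∷ T ∷ m ∷ p ∷ []))

      J⊆two-intervals : ∀ j → j ∈ J →
                        (T + m ≤ toℕ j < 2 * m + d) ⊎ (m ∸ d ≤ toℕ j < T + 2 * m ∸ p)
      J⊆two-intervals j j∈J with T + m ≤? toℕ j
      ... | yes T+m≤j = inj₁ (T+m≤j , proj₂ (J⊆range j j∈J))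
      ... | no  T+m≰j = inj₂ (proj₁ (J⊆range j j∈J) ,
                              m+n≤o⇒m≤o∸n (suc (toℕ j)) (proj₂ (wrapped j∈J (≰⇒> T+m≰j))))

      two-intervals-absurd : ∀ c C → d + k + (T + m + c) ≤ 2 * m + d + C → m ≤ c + d →
                             C + p ≤ T + 2 * m → ⊥
      two-intervals-absurd c C count m≤c+d C+p≤T+2m = sum-contradiction
        (count ⊕ m≤c+d ⊕ C+p≤T+2m ⊕ ≤-reflexive 3m≡p+1 ⊕ d<m ⊕ 0<k) 0
        (solve (c ∷ C ∷ T ∷ p ∷ m ∷ d ∷ k ∷ []))

      window-by-kinds : Dec (∃ λ j → j ∈ J × T + m ≤ toℕ j) →
                        Dec (∃ λ j → j ∈ J × toℕ j < T + m) → ∃ Window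
      window-by-kinds (no none-unwrapped) _ = T + m ∸ p , λ j j∈J →
        wrapped-window (wrapped j∈J (≰⇒> λ T+m≤j → none-unwrapped (j , j∈J , T+m≤j)))
      window-by-kinds _ (no none-wrapped) = T + m , λ j j∈J →
        unwrapped-window (unwrapped j∈J (≮⇒≥ λ j<T+m → none-wrapped (j , j∈J , j<T+m)))
      window-by-kinds (yes (b , b∈J , T+m≤b)) (yes (a , a∈J , a<T+m)) =
        ⊥-elim (two-intervals-absurd (m ∸ d) (T + 2 * m ∸ p)
          (∣J∣+X≤Y⇒d+k+X≤Y (∣p∣+[a+c]≤b+e J T+m≤2m+d m∸d≤T+2m∸p J⊆two-intervals))
          (≤-reflexive (sym (m∸n+n≡m (<⇒≤ d<m))))
          (≤-reflexive (m∸n+n≡m (≤-trans (m≤n+m p (toℕ a)) (<⇒≤ a+p<T+2m)))))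
        where
        T+m≤2m+d : T + m ≤ 2 * m + d
        T+m≤2m+d = ≤-trans T+m≤b (<⇒≤ (proj₂ (J⊆range b b∈J)))
        a+p<T+2m : toℕ a + p < T + 2 * m
        a+p<T+2m = proj₂ (wrapped a∈J a<T+m)
        m∸d≤T+2m∸p : m ∸ d ≤ T + 2 * m ∸ p
        m∸d≤T+2m∸p =
          ≤-trans (proj₁ (J⊆range a a∈J)) (<⇒≤ (m+n≤o⇒m≤o∸n (suc (toℕ a)) a+p<T+2m))

    window : ∃ Window
    window = window-by-kinds (any? (λ j → j ∈? J ×-dec (T + m ≤? toℕ j)))
                             (any? (λ j → j ∈? J ×-dec (toℕ j <? T + m)))

  module _ {s y : ℕ} (J⊆window : Window s) (p<y+k : p < y + k) (y<p+k : y < p + k)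
           (misses : Misses y) where

    private
      near-or-far : ∀ j → j ∈ J → y < toℕ j + m ⊎ toℕ j + 2 * m ≤ y
      near-or-far j j∈J with offset-trichotomy {m} {2 * m} (toℕ j) y
      ... | inj₁ near                     = inj₁ near
      ... | inj₂ (inj₁ (i , i∈I , i+j≡y)) = contradiction i+j≡y (misses j j∈J i i∈I)
      ... | inj₂ (inj₂ far)               = inj₂ far

      all-near-absurd : ∀ a → d + k + a ≤ 2 * m + d → suc y ≤ m + a → ⊥
      all-near-absurd a count y<m+a = sum-contradiction
        (count ⊕ y<m+a ⊕ p<y+k ⊕ ≤-reflexive 3m≡p+1) 0 (solve (a ∷ y ∷ p ∷ m ∷ d ∷ k ∷ []))

      all-far-absurd : ∀ c → d + k + c + 2 * m ≤ suc y → m ≤ c + d → ⊥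
      all-far-absurd c count m≤c+d = sum-contradiction
        (count ⊕ y<p+k ⊕ m≤c+d ⊕ ≤-reflexive (sym 3m≡p+1)) 0
        (solve (c ∷ y ∷ p ∷ m ∷ d ∷ k ∷ []))

      near-far-absurd : ∀ u v → u + 2 * m ≤ y → y < v + m → s ≤ u → v < s + m → ⊥
      near-far-absurd u v u-far v-near s≤u v<s+m = sum-contradiction
        (u-far ⊕ v-near ⊕ s≤u ⊕ v<s+m) 1 (solve (u ∷ v ∷ s ∷ y ∷ m ∷ []))

      absurd-by-sides : Dec (∃ λ j → j ∈ J × toℕ j + 2 * m ≤ y) →
                        Dec (∃ λ j → j ∈ J × y < toℕ j + m) → ⊥
      absurd-by-sides (no none-far) _ =
        all-near-absurd (suc y ∸ m) (⊆interval⇒d+k+a≤b near-bounds) (m≤n+m∸n (suc y) m)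
        where
        near-bounds : ∀ j → j ∈ J → suc y ∸ m ≤ toℕ j < 2 * m + d
        near-bounds j j∈J =
          [ (λ near → m≤n+o⇒m∸n≤o (suc y) m (subst (suc y ≤_) (+-comm (toℕ j) m) near))
          , (λ far → contradiction (j , j∈J , far) none-far) ]′ (near-or-far j j∈J)
          , proj₂ (J⊆range j j∈J)
      absurd-by-sides _ (no none-near) = all-far-absurd (m ∸ d)
        (0<m≤o∸n⇒m+n≤o (≤-trans 0<d+k (m≤m+n (d + k) (m ∸ d))) (⊆interval⇒d+k+a≤b far-bounds))
        (≤-reflexive (sym (m∸n+n≡m (<⇒≤ d<m))))
        where
        far-bounds : ∀ j → j ∈ J → m ∸ d ≤ toℕ j < suc y ∸ 2 * m
        far-bounds j j∈J = proj₁ (J⊆range j j∈J) ,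
          [ (λ near → contradiction (j , j∈J , near) none-near)
          , (λ far → m+n≤o⇒m≤o∸n (suc (toℕ j)) (s≤s far)) ]′ (near-or-far j j∈J)
      absurd-by-sides (yes (a , a∈J , a-far)) (yes (b , b∈J , b-near)) =
        near-far-absurd _ _ a-far b-near (proj₁ (J⊆window a a∈J)) (proj₂ (J⊆window b b∈J))

    no-misses : ⊥
    no-misses = absurd-by-sides (any? (λ j → j ∈? J ×-dec (toℕ j + 2 * m ≤? y)))
                                (any? (λ j → j ∈? J ×-dec (y <? toℕ j + m)))

interval-or-lift : ∀ {p k x} → 0 < k → x < p →
                   (k ≤ x × x ≤ k + (p ∸ 2 * k)) ⊎
                   (∃[ q ] (p < x + q * p + k × x + q * p < p + k))
interval-or-lift {p} {k} {x} 0<k x<p with k ≤? x | x ≤? k + (p ∸ 2 * k)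
... | yes k≤x | yes x≤k+r = inj₁ (k≤x , x≤k+r)
... | no  k≰x | _         = inj₂ (1 , p<y+k , y<p+k)
  where
  p<y+k : p < x + 1 * p + k
  p<y+k = ≰⇒> λ (y+k≤p : x + 1 * p + k ≤ p) →
    sum-contradiction (y+k≤p ⊕ 0<k) x (solve (x ∷ p ∷ k ∷ []))
  y<p+k : x + 1 * p < p + k
  y<p+k = ≰⇒> λ (p+k≤y : p + k ≤ x + 1 * p) →
    sum-contradiction (p+k≤y ⊕ ≰⇒> k≰x) 0 (solve (x ∷ p ∷ k ∷ []))
... | yes _   | no x≰k+r  = inj₂ (0 , p<y+k (m≤n+m∸n p (2 * k)) (≰⇒> x≰k+r) , y<p+k)
  where
  p<y+k : ∀ {r} → p ≤ 2 * k + r → k + r < x → p < x + 0 * p + k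
  p<y+k {r} p≤2k+r k+r<x = ≰⇒> λ (y+k≤p : x + 0 * p + k ≤ p) →
    sum-contradiction (y+k≤p ⊕ p≤2k+r ⊕ k+r<x) 0 (solve (x ∷ p ∷ k ∷ r ∷ []))
  y<p+k : x + 0 * p < p + k
  y<p+k = ≰⇒> λ (p+k≤y : p + k ≤ x + 0 * p) →
    sum-contradiction (p+k≤y ⊕ x<p ⊕ 0<k) 1 (solve (x ∷ p ∷ k ∷ []))

lemma4p2 : (p : ℕ) → Prime p → 11 ≤ p → p % 3 ≡ 2 →
    (m : ℕ) → 3 * m ≡ p + 1 →
    (d : ℕ) → d < m →
    (J : Subset p) →
    (∀ j → j ∈ J → InInterval p (m ∸ d) (2 * m ∸ 1 + d) j) →
    suc d ≤ ∣ J ∣ →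
    (t : Fin p) → SubsetOfTranslate p J t m (2 * m ∸ 1) →
    (x : Fin p) → ¬ InSumset p m (2 * m ∸ 1) J x →
    InInterval p (∣ J ∣ ∸ d) (∣ J ∣ ∸ d + (p ∸ 2 * (∣ J ∣ ∸ d))) x
lemma4p2 p _ _ _ m 3m≡p+1 d d<m J J⊆I±d d<∣J∣ t J⊆t+I x x∉I+J =
  [ (λ (k≤x , x≤k+r) → toℕ x , k≤x , x≤k+r , residue-toℕ x)
  , (λ (q , p<y+k , y<p+k) →
       ⊥-elim (no-misses (proj₂ (window (toℕ t) J⊆T+I)) p<y+k y<p+k (misses q))) ]′
  (interval-or-lift 0<k (toℕ<n x))
  where
  k : ℕ
  k = ∣ J ∣ ∸ d
  0<k : 0 < k
  0<k = m<n⇒0<n∸m d<∣J∣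
  0<2m : 0 < 2 * m
  0<2m = ≤-trans (≤-trans (s≤s z≤n) d<m) (m≤m+n m (m + 0))
  2m≤p : 2 * m ≤ p
  2m≤p = ≤-trans (m≤m+n (2 * m) 0) (2m+e≤p 3m≡p+1 (≤-trans (s≤s z≤n) d<m))

  J⊆range : ∀ j → j ∈ J → m ∸ d ≤ toℕ j < 2 * m + d
  J⊆range j j∈J = Product.map₂ (≤∸1+⇒<+ 0<2m)
    (InInterval⇒≤toℕ≤ (J⊆I±d j j∈J) (<-≤-trans (≤∸1+⇒<+ 0<2m ≤-refl) (2m+e≤p 3m≡p+1 d<m)))

  open Lifted 3m≡p+1 d<m J (sym (m+[n∸m]≡n (<⇒≤ d<∣J∣))) 0<k J⊆range

  J⊆T+I : ∀ j → j ∈ J → ∃[ i ] (m ≤ i < 2 * m × (toℕ j ≡ toℕ t + i ⊎ toℕ j + p ≡ toℕ t + i))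
  J⊆T+I j j∈J with SubsetOfTranslate⇒lift J⊆t+I (<-≤-trans (≤∸1⇒< 0<2m ≤-refl) 2m≤p) j j∈J
  ... | i , m≤i , i≤2m∸1 , lift = i , (m≤i , ≤∸1⇒< 0<2m i≤2m∸1) , lift

  misses : ∀ q → Misses (toℕ x + q * p)
  misses q j j∈J i (m≤i , i<2m) i+j≡y = x∉I+J (i , j , m≤i , <⇒≤∸1 i<2m , j∈J , q , i+j≡y)
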